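{- Fix $n\ge 1$ and a finite alphabet $A$. A set $L\subseteq (A^\ast)^n$ is the language accepted by some $n$-tape sorted asynchronous automaton over $A$ if and only if it is the language accepted by some $n$-tape semi-sorted asynchronous automaton over $A$.
   Context: Let $\$\notin A$ be a new symbol and $[n]=\{1,\dots,n\}$. A partial deterministic finite state automaton over an alphabet $B$ has a finite state set, a unique start state, a set of accept states, no $\epsilon$-transitions, and for each state $s$ and letter $b\in B$ at most one transition from $s$ labelled $b$. An $n$-tape semi-sorted asynchronous automaton over $A$ is a partial deterministic finite state automaton over $A\sqcup\{\$\}$ together with a partition of its state set into $n$ sets $S_1,\dots,S_n$. It accepts $(w_1,\dots,w_n)\in(A^\ast)^n$ iff there is a path of transitions $s_0\xrightarrow{a_1}s_1\xrightarrow{a_2}\cdots\xrightarrow{a_N}s_N$ from the start state $s_0$ to an accept state $s_N$ such that, for each $i\in[n]$, the concatenation (in order) of the labels $a_j$ of those transitions whose source state $s_{j-1}$ lies in $S_i$ equals $w_i\$$ (so the path spells a shuffle of $(w_1\$,\dots,w_n\$)$, a letter read from a state in $S_i$ being read from tape $i$). An $n$-tape sorted asynchronous automaton over $A$ is a partial deterministic finite state automaton $W$ over $A\sqcup\{\$\}$ whose state set is partitioned into sets $S_i^V$, one for each proper subset $V\subsetneq[n]$ and each $i\in[n]\setminus V$, together with one further set $S_f^{[n]}$, such that: the start state lies in $S_i^{\emptyset}$ for some $i$; a transition is labelled $\$$ if and only if it goes from a state in some $S_i^V$ to a state in $S_j^{U}$ where $U=V\cup\{i\}$ and $j\neq i$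 (here $S_j^{[n]}$ means $S_f^{[n]}$); every transition not labelled $\$$ starting in $S_i^V$ ends in $S_j^V$ for some $j\notin V$; $S_f^{[n]}$ consists of a single state $s^\$$, which is the unique accept state; and no transitions start in $S_f^{[n]}$. It accepts $(w_1,\dots,w_n)$ iff there is a path from the start state to $s^\$$ such that for each $i$ the concatenation of the labels of the transitions whose source lies in $\bigcup_V S_i^V$ equals $w_i\$$. -}

module Defs where

open import Data.Nat using (ℕ)
open import Data.Fin using (Fin)
open import Data.Fin.Properties using () renaming (_≟_ to _≟ᶠ_)
open import Data.Fin.Subset using (Subset; _∉_; _∪_; ⁅_⁆; ⊤) renaming (⊥ to ∅)
open import Data.List using (List; []; _∷_; _++_; map)
open import Data.Maybe using (Maybe; just; nothing)
open import Data.Bool using (Bool; true)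
open import Data.Product using (Σ; ∃; _×_)
open import Data.Sum using (_⊎_)
open import Relation.Nullary using (yes; no)
open import Relation.Binary.PropositionalEquality using (_≡_)

data Letter (A : Set) : Set where
  sym    : A → Letter A
  dollar : Letter A

Tuple : ℕ → Set → Set
Tuple n A = Fin n → List A

pushAt : ∀ {n} {B : Set} → Fin n → B → (Fin n → List B) → (Fin n → List B)
pushAt i a ws j with j ≟ᶠ i
... | yes _ = a ∷ ws j
... | no  _ = ws j

-- Reads δ tapeOf s t ws : there is a path of transitions of the partial DFA δ
-- from s to t such that, for each tape i, the concatenation of labels of those
-- transitions whose source state is assigned to tape i is ws i.
data Reads {m n : ℕ} {A : Set}
           (δ : Fin m → Letter A → Maybe (Fin m))
           (tapeOf : Fin m → Maybe (Fin n))
           : Fin m → Fin m → (Fin n → List (Letter A)) → Set where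
  done : ∀ {s} → Reads δ tapeOf s s (λ _ → [])
  step : ∀ {s s' t i ws} (a : Letter A) →
         tapeOf s ≡ just i → δ s a ≡ just s' →
         Reads δ tapeOf s' t ws → Reads δ tapeOf s t (pushAt i a ws)

input : ∀ {n} {A : Set} → Tuple n A → Fin n → List (Letter A)
input w i = map sym (w i) ++ (dollar ∷ [])

record SemiSorted (n : ℕ) (A : Set) : Set where
  field
    m      : ℕ
    δ      : Fin m → Letter A → Maybe (Fin m)
    start  : Fin m
    accept : Fin m → Bool
    tape   : Fin m → Fin n                  -- the partition S_1, …, S_n

SemiAccepts : ∀ {n A} → SemiSorted n A → Tuple n A → Set
SemiAccepts W w =
  ∃ λ t → accept t ≡ true × Reads δ (λ s → just (tape s)) start t (input w)
  where open SemiSorted W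

-- part V i : the state lies in S_i^V ;  fin : the state lies in S_f^{[n]}.
data SLabel (n : ℕ) : Set where
  part : Subset n → Fin n → SLabel n
  fin  : SLabel n

tapeOfLabel : ∀ {n} → SLabel n → Maybe (Fin n)
tapeOfLabel (part V i) = just i
tapeOfLabel fin        = nothing

record Sorted (n : ℕ) (A : Set) : Set where
  field
    m      : ℕ
    δ      : Fin m → Letter A → Maybe (Fin m)
    start  : Fin m
    accept : Fin m → Bool
    label  : Fin m → SLabel n
    label-wf   : ∀ s V i → label s ≡ part V i → i ∉ V
    start-ok   : ∃ λ i → label start ≡ part ∅ i
    dollar-ok  : ∀ s t V i → label s ≡ part V i → δ s dollar ≡ just t →
                 (V ∪ ⁅ i ⁆ ≡ ⊤ × label t ≡ fin)
                 ⊎ (∃ λ j → label t ≡ part (V ∪ ⁅ i ⁆) j)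
    letter-ok  : ∀ s t V i a → label s ≡ part V i → δ s (sym a) ≡ just t →
                 ∃ λ j → label t ≡ part V j
    final      : Fin m
    final-lab  : label final ≡ fin
    final-uniq : ∀ s → label s ≡ fin → s ≡ final
    accept-iff : ∀ s → accept s ≡ true → s ≡ final
    final-acc  : accept final ≡ true
    final-dead : ∀ a → δ final a ≡ nothing

SortedAccepts : ∀ {n A} → Sorted n A → Tuple n A → Set
SortedAccepts W w =
  ∃ λ t → accept t ≡ true × Reads δ (λ s → tapeOfLabel (label s)) start t (input w)
  where open Sorted W

-- Sorted ⇒ semi-sorted: keep the transition graph and let the states of
-- S_i^V read tape i.  The final state s^$ has no outgoing transitions, so
-- the tape it is assigned to is irrelevant (`Reads-retag`).
--
-- Semi-sorted ⇒ sorted: a product construction.  A new state is s^$ or a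
-- pair (s , V) of an old state and the set V of tapes whose $ has been
-- read, lying in S_{tape s}^V; letters keep V, a $ on tape i adds i, and
-- the $ that completes V = [n] leads to s^$ if the old target accepts.
-- Along an accepting old run the invariant `Pending` (exactly the tapes
-- in V are exhausted) holds, which lets the run be lifted (`lift`);
-- conversely new runs project to old ones (`project`).

module Submission where

open import Defs
open import Data.Nat using (ℕ; _≥_; zero; suc; _*_; _^_)
open import Data.Fin using (Fin; zero; suc; combine; remQuot)
open import Data.Fin.Properties using (remQuot-combine; 2↔Bool) renaming (_≟_ to _≟ᶠ_)
open import Data.Fin.Subset using (Subset; _∈_; _∉_; _∪_; ⁅_⁆; ⊤) renaming (⊥ to ∅)
open import Data.Fin.Subset.Properties
  using (_∈?_; ∉⊥; ∈⊤; ⊆⊤; ⊆-antisym; x∈⁅x⁆; x∈⁅y⁆⇒x≡y; x∈p∪q⁺; x∈p∪q⁻)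
open import Data.Vec using ([]; _∷_)
open import Data.Vec.Properties using (≡-dec)
open import Data.List using (List; []; _∷_; _++_; map)
open import Data.Maybe using (Maybe; just; nothing; _>>=_)
open import Data.Bool using (Bool; true; false; if_then_else_) renaming (_≟_ to _≟ᵇ_)
open import Data.Product using (∃; _×_; _,_; proj₁; proj₂; map₂; uncurry)
open import Data.Sum using (_⊎_; inj₁; inj₂)
open import Data.Empty using (⊥-elim)
open import Relation.Nullary using (¬_; Dec; yes; no)
open import Relation.Binary.PropositionalEquality
  using (_≡_; refl; trans; cong; cong₂; subst; module ≡-Reasoning) renaming (sym to ≡-sym)
open import Function.Bundles using (_⇔_; mk⇔; Inverse)
import Function.Properties.Equivalence as ⇔

nothing≢just : ∀ {B : Set} {x : B} → ¬ nothing ≡ just x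
nothing≢just ()

Reads-retag : ∀ {m n : ℕ} {A : Set} {δ : Fin m → Letter A → Maybe (Fin m)}
  {T₁ T₂ : Fin m → Maybe (Fin n)} →
  (∀ {s a s' i} → T₁ s ≡ just i → δ s a ≡ just s' → T₂ s ≡ just i) →
  ∀ {s t ws} → Reads δ T₁ s t ws → Reads δ T₂ s t ws
Reads-retag agree done                = done
Reads-retag agree (step a tape≡ δ≡ r) = step a (agree tape≡ δ≡) δ≡ (Reads-retag agree r)

pushAt-here : ∀ {n} {B : Set} (i : Fin n) (a : B) ws → pushAt i a ws i ≡ a ∷ ws i
pushAt-here i a ws with i ≟ᶠ i
... | yes _  = refl
... | no i≢i = ⊥-elim (i≢i refl)

pushAt-there : ∀ {n} {B : Set} {i j : Fin n} (a : B) ws → ¬ j ≡ i → pushAt i a ws j ≡ ws j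
pushAt-there {i = i} {j} a ws j≢i with j ≟ᶠ i
... | yes j≡i = ⊥-elim (j≢i j≡i)
... | no _    = refl

module SortedToSemi {n : ℕ} {A : Set} (i₀ : Fin n) (W : Sorted n A) where
  open Sorted W

  tapeOf : SLabel n → Fin n
  tapeOf (part V i) = i
  tapeOf fin        = i₀

  semiSorted : SemiSorted n A
  semiSorted = record
    { m = m ; δ = δ ; start = start ; accept = accept ; tape = λ s → tapeOf (label s) }

  sorted⇒semi-tape : ∀ {s a s' i} → tapeOfLabel (label s) ≡ just i → δ s a ≡ just s' →
                     just (tapeOf (label s)) ≡ just i
  sorted⇒semi-tape {s} e _ with label s
  ... | part V j = e
  ... | fin      = ⊥-elim (nothing≢just e)

  semi⇒sorted-tape : ∀ {s a s' i} → just (tapeOf (label s)) ≡ just i → δ s a ≡ just s' →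
                     tapeOfLabel (label s) ≡ just i
  semi⇒sorted-tape {s} {a} {s'} e δ≡ with label s in eq
  ... | part V j = e
  ... | fin      = ⊥-elim (nothing≢just (begin
    nothing       ≡⟨ ≡-sym (final-dead a) ⟩
    δ final a     ≡⟨ cong (λ z → δ z a) (≡-sym (final-uniq s eq)) ⟩
    δ s a         ≡⟨ δ≡ ⟩
    just s'       ∎))
    where open ≡-Reasoning

  sameLanguage : ∀ w → SortedAccepts W w ⇔ SemiAccepts semiSorted w
  sameLanguage w = mk⇔
    (λ (t , acc , r) → t , acc , Reads-retag sorted⇒semi-tape r)
    (λ (t , acc , r) → t , acc , Reads-retag semi⇒sorted-tape r)

sorted⇒semiSorted : ∀ {n A} → Fin n → (W : Sorted n A) →
  ∃ λ (W' : SemiSorted n A) → ∀ w → SortedAccepts W w ⇔ SemiAccepts W' w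
sorted⇒semiSorted i₀ W = SortedToSemi.semiSorted i₀ W , SortedToSemi.sameLanguage i₀ W

infix 4 _≟ˢ_
_≟ˢ_ : ∀ {n} (p q : Subset n) → Dec (p ≡ q)
_≟ˢ_ = ≡-dec _≟ᵇ_

module Bit = Inverse 2↔Bool

subsetToFin : ∀ {n} → Subset n → Fin (2 ^ n)
subsetToFin []      = zero
subsetToFin (b ∷ V) = combine (Bit.from b) (subsetToFin V)

finToSubset : ∀ {n} → Fin (2 ^ n) → Subset n
finToSubset {zero}  _ = []
finToSubset {suc n} x = Bit.to (proj₁ bits) ∷ finToSubset (proj₂ bits)
  where bits = remQuot {2} (2 ^ n) x

finToSubset-subsetToFin : ∀ {n} (V : Subset n) → finToSubset (subsetToFin V) ≡ V
finToSubset-subsetToFin []              = refl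
finToSubset-subsetToFin {suc n} (b ∷ V) = begin
  finToSubset (combine (Bit.from b) (subsetToFin V))
    ≡⟨ cong (λ bits → Bit.to (proj₁ bits) ∷ finToSubset (proj₂ bits))
            (remQuot-combine {k = 2 ^ n} (Bit.from b) (subsetToFin V)) ⟩
  Bit.to (Bit.from b) ∷ finToSubset (subsetToFin V)
    ≡⟨ cong₂ _∷_ (Bit.strictlyInverseˡ b) (finToSubset-subsetToFin V) ⟩
  b ∷ V ∎
  where open ≡-Reasoning

pairToFin : ∀ {m n} → Fin m → Subset n → Fin (m * 2 ^ n)
pairToFin s V = combine s (subsetToFin V)

finToPair : ∀ {m n} → Fin (m * 2 ^ n) → Fin m × Subset n
finToPair {m} {n} x = map₂ finToSubset (remQuot {m} (2 ^ n) x)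

finToPair-pairToFin : ∀ {m n} (s : Fin m) (V : Subset n) → finToPair (pairToFin s V) ≡ (s , V)
finToPair-pairToFin {n = n} s V = trans
  (cong (map₂ finToSubset) (remQuot-combine {k = 2 ^ n} s (subsetToFin V)))
  (cong (s ,_) (finToSubset-subsetToFin V))

data $-Terminated {A : Set} : List (Letter A) → Set where
  $∷[] : $-Terminated (dollar ∷ [])
  _∷_  : ∀ {xs} (a : A) → $-Terminated xs → $-Terminated (sym a ∷ xs)

$-last : ∀ {A : Set} {xs : List (Letter A)} → $-Terminated (dollar ∷ xs) → xs ≡ []
$-last $∷[] = refl

$-tail : ∀ {A : Set} {a : A} {xs} → $-Terminated (sym a ∷ xs) → $-Terminated xs
$-tail (_ ∷ rest) = rest

$-terminated : ∀ {A : Set} (u : List A) → $-Terminated (map sym u ++ dollar ∷ [])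
$-terminated []      = $∷[]
$-terminated (a ∷ u) = a ∷ $-terminated u

-- `Pending V ws`: V is exactly the set of tapes whose $ has been read,
-- i.e. finished tapes are empty and every other tape still holds u $.
record Pending {n : ℕ} {A : Set} (V : Subset n) (ws : Fin n → List (Letter A)) : Set where
  field
    finished   : ∀ {j} → j ∈ V → ws j ≡ []
    unfinished : ∀ {j} → j ∉ V → $-Terminated (ws j)
open Pending

module _ {n : ℕ} {A : Set} where

  pending-input : ∀ (w : Tuple n A) → Pending ∅ (input w)
  pending-input w = record
    { finished = λ j∈∅ → ⊥-elim (∉⊥ j∈∅) ; unfinished = λ {j} _ → $-terminated (w j) }

  pending-reading : ∀ {V i a ws} → Pending V (pushAt {n} {Letter A} i a ws) → i ∉ V
  pending-reading {i = i} {a} {ws} p i∈V with trans (≡-sym (pushAt-here i a ws)) (finished p i∈V)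
  ... | ()

  pending-head : ∀ {V i a ws} → Pending V (pushAt {n} {Letter A} i a ws) → $-Terminated (a ∷ ws i)
  pending-head {i = i} {a} {ws} p =
    subst $-Terminated (pushAt-here i a ws) (unfinished p (pending-reading p))

  pending-exhausted : ∀ {V} → Pending {n} {A} V (λ _ → []) → V ≡ ⊤
  pending-exhausted {V} p = ⊆-antisym ⊆⊤ all-finished
    where
    all-finished : ∀ {j} → j ∈ ⊤ → j ∈ V
    all-finished {j} _ with j ∈? V
    ... | yes j∈V = j∈V
    ... | no  j∉V with unfinished p j∉V
    ...   | ()

  pending-letter : ∀ {V i y ws} → Pending V (pushAt {n} {Letter A} i (sym y) ws) → Pending V ws
  pending-letter {V} {i} {y} {ws} p = record { finished = finished' ; unfinished = unfinished' }
    where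
    finished' : ∀ {j} → j ∈ V → ws j ≡ []
    finished' {j} j∈V with j ≟ᶠ i
    ... | yes refl = ⊥-elim (pending-reading p j∈V)
    ... | no j≢i   = trans (≡-sym (pushAt-there (sym y) ws j≢i)) (finished p j∈V)

    unfinished' : ∀ {j} → j ∉ V → $-Terminated (ws j)
    unfinished' {j} j∉V with j ≟ᶠ i
    ... | yes refl = $-tail (pending-head p)
    ... | no j≢i   = subst $-Terminated (pushAt-there (sym y) ws j≢i) (unfinished p j∉V)

  pending-dollar : ∀ {V i ws} → Pending V (pushAt {n} {Letter A} i dollar ws) →
                   Pending (V ∪ ⁅ i ⁆) ws
  pending-dollar {V} {i} {ws} p = record { finished = finished' ; unfinished = unfinished' }
    where
    finished' : ∀ {j} → j ∈ V ∪ ⁅ i ⁆ → ws j ≡ []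
    finished' {j} j∈V∪i with j ≟ᶠ i | x∈p∪q⁻ V ⁅ i ⁆ j∈V∪i
    ... | yes refl | _          = $-last (pending-head p)
    ... | no j≢i   | inj₁ j∈V   = trans (≡-sym (pushAt-there dollar ws j≢i)) (finished p j∈V)
    ... | no j≢i   | inj₂ j∈⁅i⁆ = ⊥-elim (j≢i (x∈⁅y⁆⇒x≡y i j∈⁅i⁆))

    unfinished' : ∀ {j} → j ∉ V ∪ ⁅ i ⁆ → $-Terminated (ws j)
    unfinished' {j} j∉V∪i with j ≟ᶠ i
    ... | yes refl = ⊥-elim (j∉V∪i (x∈p∪q⁺ (inj₂ (x∈⁅x⁆ i))))
    ... | no j≢i   = subst $-Terminated (pushAt-there dollar ws j≢i)
                       (unfinished p (λ j∈V → j∉V∪i (x∈p∪q⁺ (inj₁ j∈V))))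

module SemiToSorted {n : ℕ} {A : Set} (W : SemiSorted n A) where
  open SemiSorted W

  -- zero is the final state s^$, ⟨ s , V ⟩ is the pair (s , V).
  St : Set
  St = Fin (suc (m * 2 ^ n))

  ⟨_,_⟩ : Fin m → Subset n → St
  ⟨ s , V ⟩ = suc (pairToFin s V)

  -- Entering old state s' with finished tapes V is allowed only if tape s'
  -- is unfinished (otherwise the run could never end).
  enter : Fin m → Subset n → Maybe St
  enter s' V with tape s' ∈? V
  ... | yes _ = nothing
  ... | no  _ = just ⟨ s' , V ⟩

  afterDollar : Subset n → Fin m → Maybe St
  afterDollar U s' with U ≟ˢ ⊤
  ... | yes _ = if accept s' then just zero else nothing
  ... | no  _ = enter s' U

  move : Fin m → Subset n → Letter A → Maybe St
  move s V a with tape s ∈? V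
  ... | yes _ = nothing
  move s V (sym y) | no _ = δ s (sym y) >>= λ s' → enter s' V
  move s V dollar  | no _ = δ s dollar >>= afterDollar (V ∪ ⁅ tape s ⁆)

  -- Pairs with tape s ∈ V are unreachable; they are put into S_{tape s}^∅.
  labelOf : Fin m → Subset n → SLabel n
  labelOf s V with tape s ∈? V
  ... | yes _ = part ∅ (tape s)
  ... | no  _ = part V (tape s)

  δ' : St → Letter A → Maybe St
  δ' zero    _ = nothing
  δ' (suc x) = uncurry move (finToPair x)

  label' : St → SLabel n
  label' zero    = fin
  label' (suc x) = uncurry labelOf (finToPair x)

  accept' : St → Bool
  accept' zero    = true
  accept' (suc _) = false

  data Move (s : Fin m) (V : Subset n) : Letter A → St → Set where
    letter     : ∀ {y s'} → tape s ∉ V → δ s (sym y) ≡ just s' → tape s' ∉ V →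
                 Move s V (sym y) ⟨ s' , V ⟩
    lastDollar : ∀ {s'} → tape s ∉ V → δ s dollar ≡ just s' → V ∪ ⁅ tape s ⁆ ≡ ⊤ →
                 accept s' ≡ true → Move s V dollar zero
    dollar     : ∀ {s'} → tape s ∉ V → δ s dollar ≡ just s' → ¬ V ∪ ⁅ tape s ⁆ ≡ ⊤ →
                 tape s' ∉ V ∪ ⁅ tape s ⁆ → Move s V dollar ⟨ s' , V ∪ ⁅ tape s ⁆ ⟩

  Move-live : ∀ {s V a t} → Move s V a t → tape s ∉ V
  Move-live (letter s∉V _ _)       = s∉V
  Move-live (lastDollar s∉V _ _ _) = s∉V
  Move-live (dollar s∉V _ _ _)     = s∉V

  move-sound : ∀ {s V a t} → Move s V a t → move s V a ≡ just t
  move-sound {s} {V} (letter {s' = s'} s∉V δ≡ s'∉V) with tape s ∈? V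
  ... | yes s∈V = ⊥-elim (s∉V s∈V)
  ... | no _ rewrite δ≡ with tape s' ∈? V
  ...   | yes s'∈V = ⊥-elim (s'∉V s'∈V)
  ...   | no _     = refl
  move-sound {s} {V} (lastDollar s∉V δ≡ full acc) with tape s ∈? V
  ... | yes s∈V = ⊥-elim (s∉V s∈V)
  ... | no _ rewrite δ≡ with V ∪ ⁅ tape s ⁆ ≟ˢ ⊤
  ...   | yes _     rewrite acc = refl
  ...   | no ¬full  = ⊥-elim (¬full full)
  move-sound {s} {V} (dollar {s'} s∉V δ≡ ¬full s'∉U) with tape s ∈? V
  ... | yes s∈V = ⊥-elim (s∉V s∈V)
  ... | no _ rewrite δ≡ with V ∪ ⁅ tape s ⁆ ≟ˢ ⊤
  ...   | yes full = ⊥-elim (¬full full)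
  ...   | no _ with tape s' ∈? V ∪ ⁅ tape s ⁆
  ...     | yes s'∈U = ⊥-elim (s'∉U s'∈U)
  ...     | no _     = refl

  move-complete : ∀ s V a t → move s V a ≡ just t → Move s V a t
  move-complete s V a t e with tape s ∈? V
  ... | yes _ = ⊥-elim (nothing≢just e)
  move-complete s V (sym y) t e | no s∉V with δ s (sym y) in δ≡
  ... | nothing = ⊥-elim (nothing≢just e)
  ... | just s' with tape s' ∈? V | e
  ...   | yes _    | ()
  ...   | no s'∉V  | refl = letter s∉V δ≡ s'∉V
  move-complete s V dollar t e | no s∉V with δ s dollar in δ≡
  ... | nothing = ⊥-elim (nothing≢just e)
  ... | just s' with V ∪ ⁅ tape s ⁆ ≟ˢ ⊤
  ...   | yes full with accept s' in acc | e
  ...     | true  | refl = lastDollar s∉V δ≡ full acc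
  ...     | false | ()
  move-complete s V dollar t e | no s∉V | just s' | no ¬full
    with tape s' ∈? V ∪ ⁅ tape s ⁆ | e
  ... | yes _   | ()
  ... | no s'∉U | refl = dollar s∉V δ≡ ¬full s'∉U

  labelOf-live : ∀ {s V} → tape s ∉ V → labelOf s V ≡ part V (tape s)
  labelOf-live {s} {V} s∉V with tape s ∈? V
  ... | yes s∈V = ⊥-elim (s∉V s∈V)
  ... | no _    = refl

  labelOf-wf : ∀ s V {U i} → labelOf s V ≡ part U i → i ∉ U
  labelOf-wf s V e with tape s ∈? V | e
  ... | yes _   | refl = ∉⊥
  ... | no s∉V  | refl = s∉V

  labelOf≢fin : ∀ s V → ¬ labelOf s V ≡ fin
  labelOf≢fin s V e with tape s ∈? V | e
  ... | yes _ | ()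
  ... | no _  | ()

  label-⟨⟩ : ∀ {s} V → tape s ∉ V → label' ⟨ s , V ⟩ ≡ part V (tape s)
  label-⟨⟩ {s} V s∉V = trans (cong (uncurry labelOf) (finToPair-pairToFin s V)) (labelOf-live s∉V)

  δ'-⟨⟩ : ∀ s V a → δ' ⟨ s , V ⟩ a ≡ move s V a
  δ'-⟨⟩ s V a = cong (λ p → uncurry move p a) (finToPair-pairToFin s V)

  tape-⟨⟩ : ∀ {s} V → tape s ∉ V → tapeOfLabel (label' ⟨ s , V ⟩) ≡ just (tape s)
  tape-⟨⟩ V s∉V = cong tapeOfLabel (label-⟨⟩ V s∉V)

  letter-sorted : ∀ s V t {U i} a → labelOf s V ≡ part U i → move s V (sym a) ≡ just t →
               ∃ λ j → label' t ≡ part U j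
  letter-sorted s V t a lab e with move-complete s V (sym a) t e
  ... | letter {s' = s'} s∉V _ s'∉V with trans (≡-sym (labelOf-live s∉V)) lab
  ...   | refl = tape s' , label-⟨⟩ V s'∉V

  dollar-sorted : ∀ s V t {U i} → labelOf s V ≡ part U i → move s V dollar ≡ just t →
               (U ∪ ⁅ i ⁆ ≡ ⊤ × label' t ≡ fin) ⊎ (∃ λ j → label' t ≡ part (U ∪ ⁅ i ⁆) j)
  dollar-sorted s V t lab e with move-complete s V dollar t e
  ... | lastDollar s∉V _ full _ with trans (≡-sym (labelOf-live s∉V)) lab
  ...   | refl = inj₁ (full , refl)
  dollar-sorted s V t lab e | dollar {s' = s'} s∉V _ _ s'∉U
    with trans (≡-sym (labelOf-live s∉V)) lab
  ...   | refl = inj₂ (tape s' , label-⟨⟩ (V ∪ ⁅ tape s ⁆) s'∉U)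

  sorted : Sorted n A
  sorted = record
    { m          = suc (m * 2 ^ n)
    ; δ          = δ'
    ; start      = ⟨ start , ∅ ⟩
    ; accept     = accept'
    ; label      = label'
    ; label-wf   = λ { zero V i () ; (suc x) V i e → uncurry labelOf-wf (finToPair x) e }
    ; start-ok   = tape start , label-⟨⟩ ∅ ∉⊥
    ; dollar-ok  = λ { zero t V i () _
                     ; (suc x) t V i e d → uncurry dollar-sorted (finToPair x) t e d }
    ; letter-ok  = λ { zero t V i a () _
                     ; (suc x) t V i a e d → uncurry letter-sorted (finToPair x) t a e d }
    ; final      = zero
    ; final-lab  = refl
    ; final-uniq = λ { zero _ → refl ; (suc x) e → ⊥-elim (uncurry labelOf≢fin (finToPair x) e) }
    ; accept-iff = λ { zero _ → refl ; (suc x) () }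
    ; final-acc  = refl
    ; final-dead = λ _ → refl
    }

  T : Fin m → Maybe (Fin n)
  T s = just (tape s)

  T' : St → Maybe (Fin n)
  T' x = tapeOfLabel (label' x)

  step-⟨⟩ : ∀ {s V a t u ws} → Move s V a t → Reads δ' T' t u ws →
            Reads δ' T' ⟨ s , V ⟩ u (pushAt (tape s) a ws)
  step-⟨⟩ {s} {V} {a} mv =
    step a (tape-⟨⟩ V (Move-live mv)) (trans (δ'-⟨⟩ s V a) (move-sound mv))

  first-live : ∀ {V s t ws} → Reads δ T s t ws → Pending V ws → ¬ V ≡ ⊤ → tape s ∉ V
  first-live done              p ¬full = ⊥-elim (¬full (pending-exhausted p))
  first-live (step _ refl _ _) p _     = pending-reading p

  lift : ∀ {s t ws} V → Reads δ T s t ws → accept t ≡ true → Pending V ws → ¬ V ≡ ⊤ →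
         Reads δ' T' ⟨ s , V ⟩ zero ws
  lift V done _ p ¬full = ⊥-elim (¬full (pending-exhausted p))
  lift V (step (sym y) refl δ≡ r) acc p ¬full =
    let p' = pending-letter p
    in step-⟨⟩ (letter (pending-reading p) δ≡ (first-live r p' ¬full)) (lift V r acc p' ¬full)
  lift {s} V (step dollar refl δ≡ r) acc p _ with V ∪ ⁅ tape s ⁆ ≟ˢ ⊤
  ... | no ¬full' =
    let p' = pending-dollar p
    in step-⟨⟩ (dollar (pending-reading p) δ≡ ¬full' (first-live r p' ¬full'))
               (lift _ r acc p' ¬full')
  ... | yes full with r    -- every tape is now finished, so the old run stops here
  ...   | done             = step-⟨⟩ (lastDollar (pending-reading p) δ≡ full acc) done
  ...   | step _ refl _ _  =
    ⊥-elim (pending-reading (pending-dollar p) (subst (_ ∈_) (≡-sym full) ∈⊤))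

  extend : ∀ {s s' a ws} → δ s a ≡ just s' → (∃ λ t → accept t ≡ true × Reads δ T s' t ws) →
           ∃ λ t → accept t ≡ true × Reads δ T s t (pushAt (tape s) a ws)
  extend {a = a} δs≡ (t , acc , r) = t , acc , step a refl δs≡ r

  project : ∀ {s} V {t' ws} → Reads δ' T' ⟨ s , V ⟩ t' ws → accept' t' ≡ true →
            ∃ λ t → accept t ≡ true × Reads δ T s t ws
  project V done ()
  project {s} V (step a tape≡ δ≡ r) acc
    with move-complete s V a _ (trans (≡-sym (δ'-⟨⟩ s V a)) δ≡)
  ... | mv with trans (≡-sym (tape-⟨⟩ V (Move-live mv))) tape≡
  ...   | refl with mv
  ...     | letter _ δs≡ _   = extend δs≡ (project V r acc)
  ...     | dollar _ δs≡ _ _ = extend δs≡ (project (V ∪ ⁅ tape s ⁆) r acc)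
  ...     | lastDollar {s'} _ δs≡ _ acc' with r    -- s^$ has no transitions
  ...       | done            = s' , acc' , step a refl δs≡ done
  ...       | step _ _ () _

  -- Runs start with no tape finished, which is not all tapes as n ≥ 1.
  sameLanguage : Fin n → ∀ w → SemiAccepts W w ⇔ SortedAccepts sorted w
  sameLanguage i₀ w = mk⇔
    (λ (t , acc , r) → zero , refl ,
       lift ∅ r acc (pending-input w) (λ ∅≡⊤ → ∉⊥ (subst (i₀ ∈_) (≡-sym ∅≡⊤) ∈⊤)))
    (λ (t , acc , r) → project ∅ r acc)

semiSorted⇒sorted : ∀ {n A} → Fin n → (W : SemiSorted n A) →
  ∃ λ (W' : Sorted n A) → ∀ w → SemiAccepts W w ⇔ SortedAccepts W' w
semiSorted⇒sorted i₀ W = SemiToSorted.sorted W , SemiToSorted.sameLanguage W i₀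

mainTheorem1 : (n : ℕ) → n ≥ 1 → (k : ℕ) → (L : Tuple n (Fin k) → Set) →
    (∃ λ (W : Sorted n (Fin k)) → ∀ w → L w ⇔ SortedAccepts W w)
    ⇔ (∃ λ (W : SemiSorted n (Fin k)) → ∀ w → L w ⇔ SemiAccepts W w)
mainTheorem1 zero    () k L
mainTheorem1 (suc n) _  k L = mk⇔
  (λ (W , L≡W) → let (W' , W≡W') = sorted⇒semiSorted zero W
                 in W' , λ w → ⇔.trans (L≡W w) (W≡W' w))
  (λ (W , L≡W) → let (W' , W≡W') = semiSorted⇒sorted zero W
                 in W' , λ w → ⇔.trans (L≡W w) (W≡W' w))
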